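{- Let $I=[a,b]$ be an interval, $\psi_l$ and $\psi_r$ MTL formulae, and $\pi$ a lasso trace. For every $t\in\mathbb{N}$, let $I'=\mathrm{WeakenUDirect}(\psi_l,\psi_r,I,\pi,t)$. Then either $I'$ is an optimal right-bound extension of $I$ (with respect to $\psi_l,\psi_r,\mathcal{U},\pi,t$) and $\pi,t\vDash\psi_l\,\mathcal{U}_{I'}\,\psi_r$, or $I'=\mathrm{None}$, in which case there exists no right-bound extension $I''$ of $I$ such that $\pi,t\vDash\psi_l\,\mathcal{U}_{I''}\,\psi_r$.
   Context: Intervals are $[a,b]$ with $a\in\mathbb{N}$, $b\in\mathbb{N}\cup\{\infty\}$, $a\le b$, viewed as sets of naturals. MTL formulae over propositions $\mathcal{P}$: $\phi ::= p \mid \top \mid \neg\phi \mid \phi\land\phi \mid \phi\,\mathcal{U}_I\,\phi \mid \phi\,\mathcal{R}_I\,\phi$. Traces are infinite sequences of subsets of $\mathcal{P}$; $\pi,t\vDash p$ iff $p\in\pi(t)$; $\neg,\land,\top$ as usual; $\pi,t\vDash\phi_1\,\mathcal{U}_I\,\phi_2$ iff there is $i\in I$ with $\pi,t+i\vDash\phi_2$ and $\pi,t+j\vDash\phi_1$ for all $j\in[0,i)\cap I$; $\phi_1\,\mathcal{R}_I\,\phi_2$ means $\neg(\neg\phi_1\,\mathcal{U}_I\,\neg\phi_2)$. For $I=[a,b]$ and $i\in\mathbb{N}$: $[a,b+i]$ is a right-bound extension of $I$, and (if $i\le b-a$) $[a,b-i]$ is a right-bound contraction of $I$; these are strict if $i>0$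 (with $\infty\pm i=\infty$). A lasso trace is $\pi=\pi_{\mathrm{pre}}(\pi_{\mathrm{suf}})^\omega$ with finite minimal prefix $\pi_{\mathrm{pre}}$ and nonempty finite minimal repeating word $\pi_{\mathrm{suf}}$; $|\pi|=|\pi_{\mathrm{pre}}|+|\pi_{\mathrm{suf}}|$; $\mathrm{end}_\pi(a)=|\pi|$ if $a<|\pi_{\mathrm{pre}}|$ and $\mathrm{end}_\pi(a)=a+|\pi_{\mathrm{suf}}|-1$ otherwise. The procedure $\mathrm{WeakenUDirect}(\psi_l,\psi_r,[a,b],\pi,t)$: for $i=a,a+1,\dots,\mathrm{end}_\pi(a)$ in order: if $\pi,t+i\vDash\psi_r$, return $[a,\max(b,i)]$; otherwise, if $\pi,t+i\nvDash\psi_l$, exit the loop. If the loop exits (by break or completion) without returning, return $\mathrm{None}$. An interval $I'$ is an optimal right-bound extension of $I$ with respect to $\psi_l,\psi_r,\mathcal{U},\pi,t$ if $I'$ is a right-bound extension of $I$, $\pi,t\vDash\psi_l\,\mathcal{U}_{I'}\,\psi_r$, and either $I'=I$ or there is no strict right-bound contraction $I''$ of $I'$ with $\pi,t\vDash\psi_l\,\mathcal{U}_{I''}\,\psi_r$. -}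

module Defs where

open import Data.Nat using (ℕ; zero; suc; _+_; _∸_; _≤_; _<_; _⊔_; NonZero)
open import Data.Nat.Properties using (≤-trans; m≤m⊔n)
open import Data.Nat.DivMod using (_%_)
open import Data.Bool using (Bool; true)
open import Data.List using (List; []; _∷_; length; lookup)
open import Data.Fin using (fromℕ<)
open import Data.Maybe using (Maybe; just; nothing)
open import Data.Product using (Σ; _×_; _,_)
open import Data.Sum using (_⊎_)
open import Data.Unit using (⊤; tt)
open import Relation.Nullary using (¬_; Dec; yes; no)
open import Relation.Binary.PropositionalEquality using (_≡_)

data ℕ∞ : Set where
  fin : ℕ → ℕ∞
  ∞   : ℕ∞

_≤∞_ : ℕ → ℕ∞ → Set
n ≤∞ fin m = n ≤ m
n ≤∞ ∞     = ⊤

_+∞_ : ℕ∞ → ℕ → ℕ∞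
fin m +∞ i = fin (m + i)
∞     +∞ i = ∞

_-∞_ : ℕ∞ → ℕ → ℕ∞
fin m -∞ i = fin (m ∸ i)
∞     -∞ i = ∞

max∞ : ℕ∞ → ℕ → ℕ∞
max∞ (fin m) i = fin (m ⊔ i)
max∞ ∞       i = ∞

record Interval : Set where
  constructor [_,_]⟨_⟩
  field
    lo  : ℕ
    hi  : ℕ∞
    lo≤hi : lo ≤∞ hi
open Interval public

_∈I_ : ℕ → Interval → Set
i ∈I I = (lo I ≤ i) × (i ≤∞ hi I)

RBExt : Interval → Interval → Set
RBExt I I' = (lo I' ≡ lo I) × Σ ℕ (λ i → hi I' ≡ hi I +∞ i)

StrictRBContr : Interval → Interval → Set
StrictRBContr I I'' =
  (lo I'' ≡ lo I) × Σ ℕ (λ i → (0 < i) × (i ≤∞ (hi I -∞ lo I)) × (hi I'' ≡ hi I -∞ i))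

data Formula (P : Set) : Set where
  prop : P → Formula P
  tt   : Formula P
  ~_   : Formula P → Formula P
  _∧_  : Formula P → Formula P → Formula P
  _U⟨_⟩_ : Formula P → Interval → Formula P → Formula P
  _R⟨_⟩_ : Formula P → Interval → Formula P → Formula P

Trace : Set → Set
Trace P = ℕ → P → Bool

Sat : {P : Set} → Trace P → ℕ → Formula P → Set
Sat π t (prop p) = π t p ≡ true
Sat π t tt = ⊤
Sat π t (~ φ) = ¬ Sat π t φ
Sat π t (φ ∧ ψ) = Sat π t φ × Sat π t ψ
Sat π t (φ U⟨ I ⟩ ψ) =
  Σ ℕ λ i → i ∈I I × Sat π (t + i) ψ × (∀ j → j < i → j ∈I I → Sat π (t + j) φ)
-- φ R_I ψ  :=  ¬ (¬φ U_I ¬ψ), unfolded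
Sat π t (φ R⟨ I ⟩ ψ) =
  ¬ (Σ ℕ λ i → i ∈I I × ¬ Sat π (t + i) ψ × (∀ j → j < i → j ∈I I → ¬ Sat π (t + j) φ))

-- the trace denoted by a prefix and a nonempty repeating word s ∷ ss
lassoTrace : {P : Set} → List (P → Bool) → (P → Bool) → List (P → Bool) → Trace P
lassoTrace {P} pre s ss t = go pre t
  where
  sufAt : ℕ → P → Bool
  sufAt k = lookup (s ∷ ss) (fromℕ< (Data.Nat.DivMod.m%n<n k (suc (length ss))))
  go : List (P → Bool) → ℕ → P → Bool
  go []        k       = sufAt k
  go (x ∷ xs)  zero    = x
  go (x ∷ xs)  (suc k) = go xs k

SameTrace : {P : Set} → Trace P → Trace P → Set
SameTrace {P} π π' = ∀ (t : ℕ) (p : P) → π t p ≡ π' t p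

record Lasso (P : Set) : Set where
  field
    pre : List (P → Bool)
    s₀  : P → Bool
    ss  : List (P → Bool)
  suf : List (P → Bool)
  suf = s₀ ∷ ss
  trace : Trace P
  trace = lassoTrace pre s₀ ss
  field
    minimal : ∀ (pre' : List (P → Bool)) (s' : P → Bool) (ss' : List (P → Bool)) →
              SameTrace (lassoTrace pre' s' ss') trace →
              (length pre ≤ length pre') × (length suf ≤ length (s' ∷ ss'))
open Lasso public

∣_∣L : {P : Set} → Lasso P → ℕ
∣ π ∣L = length (pre π) + length (suf π)

endπ : {P : Set} → Lasso P → ℕ → ℕ
endπ π a with a Data.Nat.<? length (pre π)
... | yes _ = ∣ π ∣L
... | no _  = a + length (suf π) ∸ 1

weakenUDirect : {P : Set} (ψl ψr : Formula P) (I : Interval) (π : Lasso P) (t : ℕ) →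
  (decl : ∀ k → Dec (Sat (trace π) k ψl)) →
  (decr : ∀ k → Dec (Sat (trace π) k ψr)) →
  Maybe Interval
weakenUDirect ψl ψr [ a , b ]⟨ a≤b ⟩ π t decl decr =
  loop a (suc (endπ π a) ∸ a)
  where
  a≤max : ∀ b i → a ≤∞ b → a ≤∞ max∞ b i
  a≤max (fin m) i p = ≤-trans p (m≤m⊔n m i)
  a≤max ∞ i p = tt
  -- iterate i = a, a+1, …, end_π(a)  (fuel = number of remaining iterations)
  loop : ℕ → ℕ → Maybe Interval
  loop i zero = nothing
  loop i (suc f) with decr (t + i)
  ... | yes _ = just [ a , max∞ b i ]⟨ a≤max b i a≤b ⟩
  ... | no _ with decl (t + i)
  ...   | yes _ = loop (suc i) f
  ...   | no _  = nothing

OptimalRBExt : {P : Set} (ψl ψr : Formula P) (π : Trace P) (t : ℕ) (I I' : Interval) → Set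
OptimalRBExt ψl ψr π t I I' =
  RBExt I I' × Sat π t (ψl U⟨ I' ⟩ ψr) ×
  (I' ≡ I ⊎ (∀ I'' → StrictRBContr I' I'' → ¬ Sat π t (ψl U⟨ I'' ⟩ ψr)))

{-# OPTIONS --safe #-}
module Submission where

-- Throughout the
-- scan ψr fails on [a,i), so a ψr-hit at i makes [a, max(b,i)] the least right-bound
-- extension that works, and a position where both fail cuts off every later witness.
-- If the scan passes end_π(a) without success there is no witness at all: beyond
-- end_π(a) the suffix of the lasso from t+i equals the one from t+i−|suf|, which is
-- still ≥ a and inside the periodic part, so every ψr-witness i ≥ a has a copy in
-- [a, end_π(a)].

open import Defs
open import Data.Nat using (ℕ; zero; suc; _+_; _∸_; _≤_; _<_; _⊔_; z≤n; s≤s; _<?_; _≤?_)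
open import Data.Nat.Properties
open import Data.Nat.DivMod using ([m+n]%n≡m%n)
open import Data.Nat.Induction using (<-wellFounded)
open import Induction.WellFounded using (Acc; acc)
open import Data.Fin.Properties using (fromℕ<-cong)
open import Data.Bool using (Bool)
open import Data.List using (List; []; _∷_; length; lookup)
open import Data.Maybe using (Maybe; just; nothing)
open import Data.Product using (Σ; _×_; _,_; proj₁; proj₂)
open import Data.Sum using (_⊎_; inj₁; inj₂)
open import Data.Unit using (tt)
open import Data.Empty using (⊥-elim)
open import Relation.Nullary using (¬_; Dec; yes; no)
open import Relation.Binary.PropositionalEquality

SameSuffix : {P : Set} → Trace P → ℕ → ℕ → Set
SameSuffix π k k′ = ∀ d → π (k + d) ≗ π (k′ + d)

module _ {P : Set} {π : Trace P} where

  sameSuffix-refl : ∀ {k} → SameSuffix π k k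
  sameSuffix-refl d p = refl

  sameSuffix-sym : ∀ {k k′} → SameSuffix π k k′ → SameSuffix π k′ k
  sameSuffix-sym e d p = sym (e d p)

  sameSuffix-trans : ∀ {k k′ k″} → SameSuffix π k k′ → SameSuffix π k′ k″ → SameSuffix π k k″
  sameSuffix-trans e e′ d p = trans (e d p) (e′ d p)

  sameSuffix-head : ∀ {k k′} → SameSuffix π k k′ → π k ≗ π k′
  sameSuffix-head {k} {k′} e p =
    subst₂ (λ m n → π m p ≡ π n p) (+-identityʳ k) (+-identityʳ k′) (e 0 p)

  sameSuffix-shift : ∀ {k k′} i → SameSuffix π k k′ → SameSuffix π (k + i) (k′ + i)
  sameSuffix-shift {k} {k′} i e d p =
    subst₂ (λ m n → π m p ≡ π n p) (sym (+-assoc k i d)) (sym (+-assoc k′ i d)) (e (i + d) p)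

  sat-sameSuffix : ∀ {k k′} (φ : Formula P) → SameSuffix π k k′ → Sat π k φ → Sat π k′ φ
  sat-sameSuffix (prop p) e s = trans (sym (sameSuffix-head e p)) s
  sat-sameSuffix tt e s = tt
  sat-sameSuffix (~ φ) e s s′ = s (sat-sameSuffix φ (sameSuffix-sym e) s′)
  sat-sameSuffix (φ ∧ ψ) e (sφ , sψ) = sat-sameSuffix φ e sφ , sat-sameSuffix ψ e sψ
  sat-sameSuffix (φ U⟨ I ⟩ ψ) e (i , i∈I , sψ , sφ) =
    i , i∈I , sat-sameSuffix ψ (sameSuffix-shift i e) sψ ,
    λ j j<i j∈I → sat-sameSuffix φ (sameSuffix-shift j e) (sφ j j<i j∈I)
  sat-sameSuffix (φ R⟨ I ⟩ ψ) e s (i , i∈I , ¬sψ , ¬sφ) =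
    s (i , i∈I , (λ sψ → ¬sψ (sat-sameSuffix ψ (sameSuffix-shift i e) sψ)) ,
       λ j j<i j∈I sφ → ¬sφ j j<i j∈I (sat-sameSuffix φ (sameSuffix-shift j e) sφ))

lassoTrace-periodic : {P : Set} (pre : List (P → Bool)) (s : P → Bool) (ss : List (P → Bool)) →
  ∀ {x} → length pre ≤ x → lassoTrace pre s ss (x + suc (length ss)) ≗ lassoTrace pre s ss x
lassoTrace-periodic [] s ss {x} _ p =
  cong (λ k → lookup (s ∷ ss) k p) (fromℕ<-cong _ _ ([m+n]%n≡m%n x (suc (length ss))) _ _)
lassoTrace-periodic (_ ∷ pre) s ss {suc x} (s≤s pre≤x) = lassoTrace-periodic pre s ss pre≤x

lasso-sameSuffix : {P : Set} (π : Lasso P) → ∀ {x} → length (pre π) ≤ x →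
                   SameSuffix (trace π) (x + length (suf π)) x
lasso-sameSuffix π {x} pre≤x d p =
  begin
    trace π (x + L + d) p    ≡⟨ cong (λ n → trace π n p) (+-assoc x L d) ⟩
    trace π (x + (L + d)) p  ≡⟨ cong (λ n → trace π (x + n) p) (+-comm L d) ⟩
    trace π (x + (d + L)) p  ≡⟨ cong (λ n → trace π n p) (sym (+-assoc x d L)) ⟩
    trace π (x + d + L) p    ≡⟨ lassoTrace-periodic (pre π) (s₀ π) (ss π) (≤-trans pre≤x (m≤m+n x d)) p ⟩
    trace π (x + d) p        ∎
  where
  open ≡-Reasoning
  L = length (suf π)

module _ {P : Set} (π : Lasso P) (a : ℕ) where

  private
    L = length (suf π)

    a+L∸1≡a+∣ss∣ : a + L ∸ 1 ≡ a + length (ss π)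
    a+L∸1≡a+∣ss∣ = +-∸-assoc a (s≤s z≤n)

  a≤endπ : a ≤ endπ π a
  a≤endπ with a <? length (pre π)
  ... | yes a<pre = ≤-trans (<⇒≤ a<pre) (m≤m+n _ L)
  ... | no _      = subst (a ≤_) (sym a+L∸1≡a+∣ss∣) (m≤m+n a (length (ss π)))

  endπ<⇒ : ∀ {i} → endπ π a < i → (a + L ≤ i) × (∣ π ∣L ≤ i)
  endπ<⇒ {i} end<i with a <? length (pre π)
  ... | yes a<pre = ≤-trans (+-monoˡ-≤ L (<⇒≤ a<pre)) (<⇒≤ end<i) , <⇒≤ end<i
  ... | no a≮pre  = a+L≤i , ≤-trans (+-monoˡ-≤ L (≮⇒≥ a≮pre)) a+L≤i
    where
    a+L≤i : a + L ≤ i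
    a+L≤i = subst (_≤ i) (sym (+-suc a (length (ss π))))
                  (subst (λ e → suc e ≤ i) a+L∸1≡a+∣ss∣ end<i)

  sameSuffix-window : ∀ t {i} → a ≤ i →
    Σ ℕ λ j → (a ≤ j) × (j ≤ endπ π a) × SameSuffix (trace π) (t + i) (t + j)
  sameSuffix-window t a≤i = go a≤i (<-wellFounded _)
    where
    go : ∀ {i} → a ≤ i → Acc _<_ i →
         Σ ℕ λ j → (a ≤ j) × (j ≤ endπ π a) × SameSuffix (trace π) (t + i) (t + j)
    go {i} a≤i (acc rec) with i ≤? endπ π a
    ... | yes i≤end = i , a≤i , i≤end , sameSuffix-refl {π = trace π}
    ... | no i≰end  =
      let (j , a≤j , j≤end , same) = go a≤i-L (rec i-L<i)
      in j , a≤j , j≤end , sameSuffix-trans {π = trace π} back same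
      where
      bounds = endπ<⇒ (≰⇒> i≰end)
      L≤i : L ≤ i
      L≤i = m+n≤o⇒n≤o a (proj₁ bounds)
      a≤i-L : a ≤ i ∸ L
      a≤i-L = m+n≤o⇒m≤o∸n a (proj₁ bounds)
      i-L<i : i ∸ L < i
      i-L<i = ∸-monoʳ-< {o = 0} (s≤s z≤n) L≤i
      pre≤t+i-L : length (pre π) ≤ t + (i ∸ L)
      pre≤t+i-L = ≤-trans (m+n≤o⇒m≤o∸n (length (pre π)) (proj₂ bounds)) (m≤n+m _ t)
      t+i-L+L≡t+i : t + (i ∸ L) + L ≡ t + i
      t+i-L+L≡t+i = trans (+-assoc t (i ∸ L) L) (cong (t +_) (m∸n+n≡m L≤i))
      back : SameSuffix (trace π) (t + i) (t + (i ∸ L))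
      back = subst (λ k → SameSuffix (trace π) k (t + (i ∸ L))) t+i-L+L≡t+i
                   (lasso-sameSuffix π pre≤t+i-L)

≤-≤∞-trans : ∀ {i j} h → i ≤ j → j ≤∞ h → i ≤∞ h
≤-≤∞-trans (fin m) i≤j j≤m = ≤-trans i≤j j≤m
≤-≤∞-trans ∞       _   _   = tt

≤∞-max∞ : ∀ b i → i ≤∞ max∞ b i
≤∞-max∞ (fin m) i = m≤n⊔m m i
≤∞-max∞ ∞       i = tt

max∞-extends : ∀ b i → Σ ℕ λ k → max∞ b i ≡ b +∞ k
max∞-extends (fin m) i = m ⊔ i ∸ m , cong fin (sym (m+[n∸m]≡n (m≤m⊔n m i)))
max∞-extends ∞       i = 0 , refl

≤∞-irrelevant : ∀ {i} h (p q : i ≤∞ h) → p ≡ q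
≤∞-irrelevant (fin m) p q = ≤-irrelevant p q
≤∞-irrelevant ∞       p q = refl

Interval-≡ : ∀ {I J} → lo I ≡ lo J → hi I ≡ hi J → I ≡ J
Interval-≡ {[ a , h ]⟨ p ⟩} {[ .a , .h ]⟨ q ⟩} refl refl = cong [ a , h ]⟨_⟩ (≤∞-irrelevant h p q)

strictRBContr-< : ∀ {a n p I″ j} → StrictRBContr [ a , fin n ]⟨ p ⟩ I″ → j ≤∞ hi I″ → j < n
strictRBContr-< {a} {n} {I″ = [ _ , .(fin (n ∸ k)) ]⟨ _ ⟩} (_ , k , 0<k , k≤n-a , refl) j≤n-k =
  ≤-<-trans j≤n-k (∸-monoʳ-< {o = 0} 0<k (≤-trans k≤n-a (m∸n≤m n a)))

module Until {P : Set} (ψl ψr : Formula P) (π : Trace P) (t a : ℕ) where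

  Pending : ℕ → Set
  Pending i = ∀ j → a ≤ j → j < i → ¬ Sat π (t + j) ψr × Sat π (t + j) ψl

  pending-start : Pending a
  pending-start j a≤j j<a = ⊥-elim (<⇒≱ j<a a≤j)

  pending-step : ∀ {i} → Pending i → ¬ Sat π (t + i) ψr → Sat π (t + i) ψl → Pending (suc i)
  pending-step pend ¬r l j a≤j j<1+i with m<1+n⇒m<n∨m≡n j<1+i
  ... | inj₁ j<i  = pend j a≤j j<i
  ... | inj₂ refl = ¬r , l

  pending-first : ∀ {i j} → Pending i → a ≤ j → Sat π (t + j) ψr → i ≤ j
  pending-first pend a≤j r = ≮⇒≥ (λ j<i → proj₁ (pend _ a≤j j<i) r)

  until-pending : ∀ {i h} (p : a ≤∞ h) → Pending i → a ≤ i → i ≤∞ h → Sat π (t + i) ψr →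
                  Sat π t (ψl U⟨ [ a , h ]⟨ p ⟩ ⟩ ψr)
  until-pending p pend a≤i i≤h r =
    _ , (a≤i , i≤h) , r , λ j j<i j∈I → proj₂ (pend j (proj₁ j∈I) j<i)

  until-blocked : ∀ {i} → Pending i → a ≤ i → ¬ Sat π (t + i) ψr → ¬ Sat π (t + i) ψl →
                  ∀ I″ → lo I″ ≡ a → ¬ Sat π t (ψl U⟨ I″ ⟩ ψr)
  until-blocked {i} pend a≤i ¬r ¬l [ _ , h ]⟨ _ ⟩ refl (i′ , (a≤i′ , i′≤h) , r′ , l′)
    with m≤n⇒m<n∨m≡n (pending-first pend a≤i′ r′)
  ... | inj₁ i<i′ = ¬l (l′ i i<i′ (a≤i , ≤-≤∞-trans h (<⇒≤ i<i′) i′≤h))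
  ... | inj₂ refl = ¬r r′

  ¬until-below : ∀ {i} → Pending i → ∀ I″ → lo I″ ≡ a → (∀ j → j ≤∞ hi I″ → j < i) →
                 ¬ Sat π t (ψl U⟨ I″ ⟩ ψr)
  ¬until-below pend [ _ , _ ]⟨ _ ⟩ refl below (i′ , (a≤i′ , i′≤hi) , r′ , _) =
    <⇒≱ (below i′ i′≤hi) (pending-first pend a≤i′ r′)

  until-optimal : ∀ {i} b (p : a ≤∞ b) (q : a ≤∞ max∞ b i) → Pending i → a ≤ i → Sat π (t + i) ψr →
                  OptimalRBExt ψl ψr π t [ a , b ]⟨ p ⟩ [ a , max∞ b i ]⟨ q ⟩
  until-optimal {i} b p q pend a≤i r =
    (refl , max∞-extends b i) , until-pending q pend a≤i (≤∞-max∞ b i) r , least b p q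
    where
    least : ∀ b (p : a ≤∞ b) (q : a ≤∞ max∞ b i) →
            [ a , max∞ b i ]⟨ q ⟩ ≡ [ a , b ]⟨ p ⟩
            ⊎ (∀ I″ → StrictRBContr [ a , max∞ b i ]⟨ q ⟩ I″ → ¬ Sat π t (ψl U⟨ I″ ⟩ ψr))
    least ∞       tt tt = inj₁ refl
    least (fin m) p  q with i ≤? m
    ... | yes i≤m = inj₁ (Interval-≡ refl (cong fin (m≥n⇒m⊔n≡m i≤m)))
    ... | no i≰m  = inj₂ λ I″ contr → ¬until-below pend I″ (proj₁ contr) λ j j≤hi →
            subst (j <_) (m≤n⇒m⊔n≡n (<⇒≤ (≰⇒> i≰m)))
                  (strictRBContr-< {a = a} {p = q} {I″ = I″} contr j≤hi)

until-exhausted : {P : Set} (ψl ψr : Formula P) (π : Lasso P) (t a : ℕ) →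
                  Until.Pending ψl ψr (trace π) t a (suc (endπ π a)) →
                  ∀ I″ → lo I″ ≡ a → ¬ Sat (trace π) t (ψl U⟨ I″ ⟩ ψr)
until-exhausted ψl ψr π t a pend I″ lo≡a (i , (lo≤i , _) , r , _) =
  let (j , a≤j , j≤end , same) = sameSuffix-window π a t (subst (_≤ i) lo≡a lo≤i)
  in <⇒≱ (s≤s j≤end) (pending-first pend a≤j (sat-sameSuffix ψr same r))
  where open Until ψl ψr (trace π) t a

-- The loop of weakenUDirect is local to it and has no name in scope.  scan is that loop:
-- the meta below is solved by unification in the last clause of weakenUDirect-continue,
-- the one place where the loop appears applied to variables only.  Then weakenUDirect
-- on [a, b] unfolds definitionally to scan … a (1 + end_π(a) ∸ a).
mutual
  scan : {P : Set} (ψl ψr : Formula P) (a : ℕ) (b : ℕ∞) → a ≤∞ b → (π : Lasso P) (t : ℕ) →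
         (∀ k → Dec (Sat (trace π) k ψl)) → (∀ k → Dec (Sat (trace π) k ψr)) →
         ℕ → ℕ → Maybe Interval
  scan = _

  weakenUDirect-continue :
    {P : Set} (ψl ψr : Formula P) (a : ℕ) (b : ℕ∞) (a≤b : a ≤∞ b) (π : Lasso P) (t : ℕ)
    (decl : ∀ k → Dec (Sat (trace π) k ψl)) (decr : ∀ k → Dec (Sat (trace π) k ψr)) →
    ¬ Sat (trace π) (t + a) ψr → Sat (trace π) (t + a) ψl →
    weakenUDirect ψl ψr [ a , b ]⟨ a≤b ⟩ π t decl decr
      ≡ scan ψl ψr a b a≤b π t decl decr (suc a) (endπ π a ∸ a)
  weakenUDirect-continue ψl ψr a b a≤b π t decl decr ¬r l
    rewrite +-∸-assoc 1 (a≤endπ π a) with decr (t + a)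
  ... | yes r = ⊥-elim (¬r r)
  ... | no _ with decl (t + a)
  ...   | no ¬l = ⊥-elim (¬l l)
  ...   | yes _ with suc a | endπ π a ∸ a
  ...     | _ | _ = refl

CorrectWeakening : {P : Set} (ψl ψr : Formula P) (π : Trace P) (t : ℕ) (I : Interval) →
                   Maybe Interval → Set
CorrectWeakening ψl ψr π t I m =
  (Σ Interval λ I′ → (m ≡ just I′) × OptimalRBExt ψl ψr π t I I′ × Sat π t (ψl U⟨ I′ ⟩ ψr))
  ⊎ ((m ≡ nothing) × (∀ I″ → RBExt I I″ → ¬ Sat π t (ψl U⟨ I″ ⟩ ψr)))

module _ {P : Set} (ψl ψr : Formula P) {a : ℕ} {b : ℕ∞} (a≤b : a ≤∞ b) (π : Lasso P) (t : ℕ)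
         (decl : ∀ k → Dec (Sat (trace π) k ψl)) (decr : ∀ k → Dec (Sat (trace π) k ψr)) where

  open Until ψl ψr (trace π) t a

  scan-correct : ∀ i f → a ≤ i → i + f ≡ suc (endπ π a) → Pending i →
                 CorrectWeakening ψl ψr (trace π) t [ a , b ]⟨ a≤b ⟩
                   (scan ψl ψr a b a≤b π t decl decr i f)
  scan-correct i zero a≤i i+0≡end+1 pend =
    inj₂ (refl , λ I″ ext → until-exhausted ψl ψr π t a pend′ I″ (proj₁ ext))
    where
    pend′ : Pending (suc (endπ π a))
    pend′ = subst Pending (trans (sym (+-identityʳ i)) i+0≡end+1) pend
  scan-correct i (suc f) a≤i i+1+f≡end+1 pend with decr (t + i)
  ... | yes r =
    let optimal = until-optimal b a≤b _ pend a≤i r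
    in inj₁ (_ , refl , optimal , proj₁ (proj₂ optimal))
  ... | no ¬r with decl (t + i)
  ...   | yes l = scan-correct (suc i) f (m≤n⇒m≤1+n a≤i) (trans (sym (+-suc i f)) i+1+f≡end+1)
                    (pending-step pend ¬r l)
  ...   | no ¬l = inj₂ (refl , λ I″ ext → until-blocked pend a≤i ¬r ¬l I″ (proj₁ ext))

lemma6 : {P : Set} (I : Interval) (ψl ψr : Formula P) (π : Lasso P) →
           (decl : ∀ k → Dec (Sat (trace π) k ψl)) →
           (decr : ∀ k → Dec (Sat (trace π) k ψr)) →
           (t : ℕ) →
           (Σ Interval λ I' → (weakenUDirect ψl ψr I π t decl decr ≡ just I') ×
              OptimalRBExt ψl ψr (trace π) t I I' × Sat (trace π) t (ψl U⟨ I' ⟩ ψr))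
           ⊎ ((weakenUDirect ψl ψr I π t decl decr ≡ nothing) ×
              (∀ I'' → RBExt I I'' → ¬ Sat (trace π) t (ψl U⟨ I'' ⟩ ψr)))
lemma6 [ a , b ]⟨ a≤b ⟩ ψl ψr π decl decr t =
  scan-correct ψl ψr a≤b π t decl decr a (suc (endπ π a) ∸ a)
    ≤-refl (m+[n∸m]≡n (m≤n⇒m≤1+n (a≤endπ π a))) pending-start
  where open Until ψl ψr (trace π) t a
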